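{- Let $H_1,H_2,H'_1,H'_2$ be sets of hypotheses over a common alphabet $\Sigma$. If $H_1$ reduces to $H'_1$, $H_2$ reduces to $H'_2$, $(H_1\cup H_2)^\star\subseteq H_2^\star\circ H_1^\star$ (pointwise), and $\mathsf{KA}_{H'_2}\vdash H'_1$, then $H_1\cup H_2$ reduces to $H'_1\cup H'_2$.
   Context: Regular expressions $T(\Sigma)$: $e,f::=e+f\mid e\cdot f\mid e^*\mid 0\mid 1\mid a$ ($a\in\Sigma$), with usual language $\llbracket e\rrbracket$. Kleene algebra axioms: idempotent semiring axioms plus $1+xx^*\le x^*$, $x+yz\le z\Rightarrow y^*x\le z$, $x+yz\le y\Rightarrow xz^*\le y$. A hypothesis is a pair $e\le f$. $\mathsf{KA}_H\vdash e=f$ means derivable in equational logic from all instances of the Kleene algebra axioms and the hypotheses in $H$, letters being constants (no substitution rule); $\mathsf{KA}_H\vdash H'$ means all inequations of $H'$ are derivable. The $H$-closure $H^\star(L)$ is the smallest language containing $L$ such that for all $e\le f\in H$ and words $u,v$, $u\llbracket f\rrbracket v\subseteq H^\star(L)$ implies $u\llbracket e\rrbracket v\subseteq H^\star(L)$. Over a common alphabet, $H$ reduces to $H'$ if $\mathsf{KA}_H\vdash H'$ and there is $r:T(\Sigma)\to T(\Sigma)$ with $\mathsf{KA}_H\vdash e=r(e)$ and $H^\star(\llbracket e\rrbracket)\subseteq H'^\star(\llbracket r(e)\rrbracket)$ for all $e$. -}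

module Defs where

open import Data.List using (List; []; _∷_; _++_)
open import Data.Product using (Σ; _×_; _,_; ∃)
open import Data.Sum using (_⊎_)
open import Relation.Binary.PropositionalEquality using (_≡_)

infixl 6 _⊕_
infixl 7 _⊙_
infix 8 _⋆

data RE (A : Set) : Set where
  _⊕_ : RE A → RE A → RE A
  _⊙_ : RE A → RE A → RE A
  _⋆  : RE A → RE A
  𝟘   : RE A
  𝟙   : RE A
  atom : A → RE A

Lang : Set → Set₁
Lang A = List A → Set

_⊆L_ : {A : Set} → Lang A → Lang A → Set
L ⊆L K = ∀ w → L w → K w

data ⟦_⟧ {A : Set} : RE A → Lang A where
  inl  : ∀ {e f w} → ⟦ e ⟧ w → ⟦ e ⊕ f ⟧ w
  inr  : ∀ {e f w} → ⟦ f ⟧ w → ⟦ e ⊕ f ⟧ w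
  cat  : ∀ {e f u v} → ⟦ e ⟧ u → ⟦ f ⟧ v → ⟦ e ⊙ f ⟧ (u ++ v)
  one  : ⟦ 𝟙 ⟧ []
  sym  : ∀ {a} → ⟦ atom a ⟧ (a ∷ [])
  nil  : ∀ {e} → ⟦ e ⋆ ⟧ []
  cons : ∀ {e u v} → ⟦ e ⟧ u → ⟦ e ⋆ ⟧ v → ⟦ e ⋆ ⟧ (u ++ v)

-- A set of hypotheses: H e f means that the hypothesis e ≤ f belongs to H
Hyps : Set → Set₁
Hyps A = RE A → RE A → Set

_∪H_ : {A : Set} → Hyps A → Hyps A → Hyps A
(H₁ ∪H H₂) e f = H₁ e f ⊎ H₂ e f

-- Derivability in equational logic from the KA axioms (all instances) and
-- the hypotheses of H (letters are constants, no substitution rule).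
infix 4 KA_⊢_≈_ KA_⊢_≤_

mutual
  KA_⊢_≤_ : {A : Set} → Hyps A → RE A → RE A → Set
  KA H ⊢ e ≤ f = KA H ⊢ e ⊕ f ≈ f

  data KA_⊢_≈_ {A : Set} (H : Hyps A) : RE A → RE A → Set where
    refl  : ∀ {e} → KA H ⊢ e ≈ e
    sym   : ∀ {e f} → KA H ⊢ e ≈ f → KA H ⊢ f ≈ e
    trans : ∀ {e f g} → KA H ⊢ e ≈ f → KA H ⊢ f ≈ g → KA H ⊢ e ≈ g
    ⊕-cong : ∀ {e e' f f'} → KA H ⊢ e ≈ e' → KA H ⊢ f ≈ f' → KA H ⊢ e ⊕ f ≈ e' ⊕ f'
    ⊙-cong : ∀ {e e' f f'} → KA H ⊢ e ≈ e' → KA H ⊢ f ≈ f' → KA H ⊢ e ⊙ f ≈ e' ⊙ f'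
    ⋆-cong : ∀ {e e'} → KA H ⊢ e ≈ e' → KA H ⊢ e ⋆ ≈ e' ⋆
    ⊕-assoc : ∀ {x y z} → KA H ⊢ x ⊕ (y ⊕ z) ≈ (x ⊕ y) ⊕ z
    ⊕-comm  : ∀ {x y} → KA H ⊢ x ⊕ y ≈ y ⊕ x
    ⊕-idem  : ∀ {x} → KA H ⊢ x ⊕ x ≈ x
    ⊕-zero  : ∀ {x} → KA H ⊢ x ⊕ 𝟘 ≈ x
    ⊙-assoc : ∀ {x y z} → KA H ⊢ x ⊙ (y ⊙ z) ≈ (x ⊙ y) ⊙ z
    ⊙-oneˡ  : ∀ {x} → KA H ⊢ 𝟙 ⊙ x ≈ x
    ⊙-oneʳ  : ∀ {x} → KA H ⊢ x ⊙ 𝟙 ≈ x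
    ⊙-zeroˡ : ∀ {x} → KA H ⊢ 𝟘 ⊙ x ≈ 𝟘
    ⊙-zeroʳ : ∀ {x} → KA H ⊢ x ⊙ 𝟘 ≈ 𝟘
    distribˡ : ∀ {x y z} → KA H ⊢ x ⊙ (y ⊕ z) ≈ (x ⊙ y) ⊕ (x ⊙ z)
    distribʳ : ∀ {x y z} → KA H ⊢ (x ⊕ y) ⊙ z ≈ (x ⊙ z) ⊕ (y ⊙ z)
    ⋆-unfold : ∀ {x} → KA H ⊢ 𝟙 ⊕ x ⊙ x ⋆ ≤ x ⋆
    ⋆-indˡ   : ∀ {x y z} → KA H ⊢ x ⊕ y ⊙ z ≤ z → KA H ⊢ y ⋆ ⊙ x ≤ z
    ⋆-indʳ   : ∀ {x y z} → KA H ⊢ x ⊕ y ⊙ z ≤ y → KA H ⊢ x ⊙ z ⋆ ≤ y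
    hyp : ∀ {e f} → H e f → KA H ⊢ e ≤ f

KA_⊢H_ : {A : Set} → Hyps A → Hyps A → Set
KA H ⊢H H' = ∀ {e f} → H' e f → KA H ⊢ e ≤ f

-- The H-closure H⋆(L): the least language containing L such that for all
-- (e ≤ f) ∈ H and words u v, u⟦f⟧v ⊆ H⋆(L) implies u⟦e⟧v ⊆ H⋆(L).
data Closure {A : Set} (H : Hyps A) (L : Lang A) : Lang A where
  base : ∀ {w} → L w → Closure H L w
  step : ∀ {e f u v x} → H e f →
         (∀ y → ⟦ f ⟧ y → Closure H L (u ++ y ++ v)) →
         ⟦ e ⟧ x → Closure H L (u ++ x ++ v)

Reduces : {A : Set} → Hyps A → Hyps A → Set
Reduces {A} H H' =
  (KA H ⊢H H') ×
  Σ (RE A → RE A) (λ r →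
     ∀ e → (KA H ⊢ e ≈ r e) × (Closure H ⟦ e ⟧ ⊆L Closure H' ⟦ r e ⟧))

{-# OPTIONS --safe #-}
-- The reduction is r₂ ∘ r₁. Its derivability part is immediate; for the closure
-- part the split hypothesis gives (H₁ ∪ H₂)⋆ ⊆ H₂⋆ ∘ H₁⋆ ⊆ H₂⋆ ∘ H₁'⋆ ⊆ H₂⋆ ∘ H₂'⋆
-- ⊆ H₂⋆ ∘ H₂⋆ = H₂⋆, after which the second reduction applies. The inclusions
-- H₁'⋆ ⊆ H₂'⋆ ⊆ H₂⋆ come from soundness: a language closed under H (in every
-- context) is closed under every inequation derivable in KA_H, which is proved by
-- reading e ≤ f relative to a fixed language K as "whenever u⟦f⟧v ⊆ K, u⟦e⟧v ⊆ K".
module Submission where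

open import Defs
open import Data.List using (List; []; _++_)
open import Data.List.Properties using (++-assoc; ++-identityʳ)
open import Data.Product using (_×_; _,_; proj₁; proj₂)
open import Data.Sum using (inj₁; inj₂)
open import Function using (_∘_)
open import Relation.Binary.PropositionalEquality as Eq using (subst; cong)

private
  variable
    A : Set
    H G H' : Hyps A
    K L M N : Lang A
    e f g e' f' x y z : RE A

infixr 9 _∘ᴸ_
_∘ᴸ_ : M ⊆L N → L ⊆L M → L ⊆L N
(i ∘ᴸ j) w = i w ∘ j w

infix 4 _⊆H_
_⊆H_ : Hyps A → Hyps A → Set
H ⊆H G = ∀ {e f} → H e f → G e f

infix 4 _≐_
_≐_ : RE A → RE A → Set
e ≐ f = (⟦ e ⟧ ⊆L ⟦ f ⟧) × (⟦ f ⟧ ⊆L ⟦ e ⟧)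

⊕-assoc-≐ : x ⊕ (y ⊕ z) ≐ (x ⊕ y) ⊕ z
⊕-assoc-≐ = (λ { _ (inl p) → inl (inl p) ; _ (inr (inl p)) → inl (inr p) ; _ (inr (inr p)) → inr p })
          , (λ { _ (inl (inl p)) → inl p ; _ (inl (inr p)) → inr (inl p) ; _ (inr p) → inr (inr p) })

⊕-comm-≐ : x ⊕ y ≐ y ⊕ x
⊕-comm-≐ = (λ { _ (inl p) → inr p ; _ (inr p) → inl p })
         , (λ { _ (inl p) → inr p ; _ (inr p) → inl p })

⊕-idem-≐ : x ⊕ x ≐ x
⊕-idem-≐ = (λ { _ (inl p) → p ; _ (inr p) → p }) , (λ _ → inl)

⊕-zero-≐ : x ⊕ 𝟘 ≐ x
⊕-zero-≐ = (λ { _ (inl p) → p ; _ (inr ()) }) , (λ _ → inl)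

⊙-assoc-≐ : x ⊙ (y ⊙ z) ≐ (x ⊙ y) ⊙ z
⊙-assoc-≐ = (λ { _ (cat {u = a} p (cat {u = b} {v = c} q r)) → subst ⟦ _ ⟧ (++-assoc a b c) (cat (cat p q) r) })
          , (λ { _ (cat {v = c} (cat {u = a} {v = b} p q) r) → subst ⟦ _ ⟧ (Eq.sym (++-assoc a b c)) (cat p (cat q r)) })

⊙-oneˡ-≐ : 𝟙 ⊙ x ≐ x
⊙-oneˡ-≐ = (λ { _ (cat one p) → p }) , (λ _ → cat one)

⊙-oneʳ-≐ : x ⊙ 𝟙 ≐ x
⊙-oneʳ-≐ = (λ { _ (cat {u = a} p one) → subst ⟦ _ ⟧ (Eq.sym (++-identityʳ a)) p })
         , (λ w p → subst ⟦ _ ⟧ (++-identityʳ w) (cat p one))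

⊙-zeroˡ-≐ : 𝟘 ⊙ x ≐ 𝟘
⊙-zeroˡ-≐ = (λ { _ (cat () _) }) , (λ { _ () })

⊙-zeroʳ-≐ : x ⊙ 𝟘 ≐ 𝟘
⊙-zeroʳ-≐ = (λ { _ (cat _ ()) }) , (λ { _ () })

distribˡ-≐ : x ⊙ (y ⊕ z) ≐ (x ⊙ y) ⊕ (x ⊙ z)
distribˡ-≐ = (λ { _ (cat p (inl q)) → inl (cat p q) ; _ (cat p (inr q)) → inr (cat p q) })
           , (λ { _ (inl (cat p q)) → cat p (inl q) ; _ (inr (cat p q)) → cat p (inr q) })

distribʳ-≐ : (x ⊕ y) ⊙ z ≐ (x ⊙ z) ⊕ (y ⊙ z)
distribʳ-≐ = (λ { _ (cat (inl p) q) → inl (cat p q) ; _ (cat (inr p) q) → inr (cat p q) })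
           , (λ { _ (inl (cat p q)) → cat (inl p) q ; _ (inr (cat p q)) → cat (inr p) q })

⋆-unfold-≐ : (𝟙 ⊕ x ⊙ x ⋆) ⊕ x ⋆ ≐ x ⋆
⋆-unfold-≐ = (λ { _ (inl (inl one)) → nil ; _ (inl (inr (cat p q))) → cons p q ; _ (inr p) → p })
           , (λ _ → inr)

module Entailment (K : Lang A) where

  infix 4 _◁_ _⊑_

  _◁_ : List A → RE A → Set
  w ◁ f = ∀ u v → (∀ y → ⟦ f ⟧ y → K (u ++ y ++ v)) → K (u ++ w ++ v)

  _⊑_ : RE A → RE A → Set
  e ⊑ f = ∀ w → ⟦ e ⟧ w → w ◁ f

  ∈⇒◁ : ∀ {w} → ⟦ f ⟧ w → w ◁ f
  ∈⇒◁ {w = w} p u v k = k w p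

  ◁-mono : ∀ {w} → ⟦ f ⟧ ⊆L ⟦ g ⟧ → w ◁ f → w ◁ g
  ◁-mono i p u v k = p u v (λ y q → k y (i y q))

  ◁-trans : ∀ {w} → w ◁ f → f ⊑ g → w ◁ g
  ◁-trans p fg u v k = p u v (λ y q → fg y q u v k)

  ◁-cat : ∀ {a b} → a ◁ e → b ◁ f → a ++ b ◁ e ⊙ f
  ◁-cat {a = a} {b} pa pb u v k =
    subst K (cong (u ++_) (Eq.sym (++-assoc a b v)))
      (pa u (b ++ v) (λ a' qa → subst K (++-assoc u a' (b ++ v))
        (pb (u ++ a') v (λ b' qb → subst K
           (Eq.trans (cong (u ++_) (++-assoc a' b' v)) (Eq.sym (++-assoc u a' (b' ++ v))))
           (k (a' ++ b') (cat qa qb))))))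

  ⊑-refl : e ⊑ e
  ⊑-refl _ = ∈⇒◁

  ⊑-trans : e ⊑ f → f ⊑ g → e ⊑ g
  ⊑-trans ef fg w p = ◁-trans (ef w p) fg

  ≐⇒⊑ : e ≐ f → (e ⊑ f) × (f ⊑ e)
  ≐⇒⊑ (i , j) = (λ w → ∈⇒◁ ∘ i w) , (λ w → ∈⇒◁ ∘ j w)

  ⊕-lub : e ⊑ g → f ⊑ g → e ⊕ f ⊑ g
  ⊕-lub eg fg w (inl p) = eg w p
  ⊕-lub eg fg w (inr p) = fg w p

  ⊕-⊑ˡ : e ⊕ f ⊑ g → e ⊑ g
  ⊕-⊑ˡ efg w = efg w ∘ inl

  ⊕-⊑ʳ : e ⊕ f ⊑ g → f ⊑ g
  ⊕-⊑ʳ efg w = efg w ∘ inr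

  ⊑⇒≤ : e ⊑ f → (e ⊕ f ⊑ f) × (f ⊑ e ⊕ f)
  ⊑⇒≤ ef = ⊕-lub ef ⊑-refl , (λ w → ∈⇒◁ ∘ inr)

  ⊕-mono : e ⊑ e' → f ⊑ f' → e ⊕ f ⊑ e' ⊕ f'
  ⊕-mono ee ff w (inl p) = ◁-mono (λ _ → inl) (ee w p)
  ⊕-mono ee ff w (inr p) = ◁-mono (λ _ → inr) (ff w p)

  ⊙-mono : e ⊑ e' → f ⊑ f' → e ⊙ f ⊑ e' ⊙ f'
  ⊙-mono ee ff _ (cat {u = a} {v = b} p q) = ◁-cat (ee a p) (ff b q)

  ⋆-mono : e ⊑ e' → e ⋆ ⊑ e' ⋆
  ⋆-mono ee _ nil = λ u v k → k [] nil
  ⋆-mono ee _ (cons {u = a} {v = w} p q) =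
    ◁-mono (λ { _ (cat r s) → cons r s }) (◁-cat (ee a p) (⋆-mono ee w q))

  ⋆-indˡ-⊑ : x ⊕ y ⊙ z ⊑ z → y ⋆ ⊙ x ⊑ z
  ⋆-indˡ-⊑ {x = x} {y} {z} xyz _ (cat {u = w} {v = s} p q) = prepend w s p (⊕-⊑ˡ xyz s q)
    where
      prepend : ∀ w s → ⟦ y ⋆ ⟧ w → s ◁ z → w ++ s ◁ z
      prepend _ s nil sz = sz
      prepend _ s (cons {u = a} {v = w'} p q) sz =
        subst (_◁ z) (Eq.sym (++-assoc a w' s))
          (◁-trans (◁-cat (∈⇒◁ {f = y} p) (prepend w' s q sz)) (⊕-⊑ʳ xyz))

  ⋆-indʳ-⊑ : x ⊕ y ⊙ z ⊑ y → x ⊙ z ⋆ ⊑ y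
  ⋆-indʳ-⊑ {x = x} {y} {z} xyz _ (cat {u = s} {v = w} p q) = append w s q (⊕-⊑ˡ xyz s p)
    where
      append : ∀ w s → ⟦ z ⋆ ⟧ w → s ◁ y → s ++ w ◁ y
      append _ s nil sy = subst (_◁ y) (Eq.sym (++-identityʳ s)) sy
      append _ s (cons {u = a} {v = w'} p q) sy =
        subst (_◁ y) (++-assoc s a w')
          (append w' (s ++ a) q (◁-trans (◁-cat sy (∈⇒◁ {f = z} p)) (⊕-⊑ʳ xyz)))

  sound : (∀ {e f} → H e f → e ⊑ f) → KA H ⊢ e ≈ f → (e ⊑ f) × (f ⊑ e)
  sound closed refl = ⊑-refl , ⊑-refl
  sound closed (sym d) with sound closed d
  ... | ef , fe = fe , ef
  sound closed (trans d d') with sound closed d | sound closed d'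
  ... | ef , fe | fg , gf = ⊑-trans ef fg , ⊑-trans gf fe
  sound closed (⊕-cong d d') with sound closed d | sound closed d'
  ... | ee , e'e | ff , f'f = ⊕-mono ee ff , ⊕-mono e'e f'f
  sound closed (⊙-cong d d') with sound closed d | sound closed d'
  ... | ee , e'e | ff , f'f = ⊙-mono ee ff , ⊙-mono e'e f'f
  sound closed (⋆-cong d) with sound closed d
  ... | ee , e'e = ⋆-mono ee , ⋆-mono e'e
  sound closed ⊕-assoc = ≐⇒⊑ ⊕-assoc-≐
  sound closed ⊕-comm = ≐⇒⊑ ⊕-comm-≐
  sound closed ⊕-idem = ≐⇒⊑ ⊕-idem-≐
  sound closed ⊕-zero = ≐⇒⊑ ⊕-zero-≐
  sound closed ⊙-assoc = ≐⇒⊑ ⊙-assoc-≐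
  sound closed ⊙-oneˡ = ≐⇒⊑ ⊙-oneˡ-≐
  sound closed ⊙-oneʳ = ≐⇒⊑ ⊙-oneʳ-≐
  sound closed ⊙-zeroˡ = ≐⇒⊑ ⊙-zeroˡ-≐
  sound closed ⊙-zeroʳ = ≐⇒⊑ ⊙-zeroʳ-≐
  sound closed distribˡ = ≐⇒⊑ distribˡ-≐
  sound closed distribʳ = ≐⇒⊑ distribʳ-≐
  sound closed ⋆-unfold = ≐⇒⊑ ⋆-unfold-≐
  sound closed (⋆-indˡ d) = ⊑⇒≤ (⋆-indˡ-⊑ (⊕-⊑ˡ (proj₁ (sound closed d))))
  sound closed (⋆-indʳ d) = ⊑⇒≤ (⋆-indʳ-⊑ (⊕-⊑ˡ (proj₁ (sound closed d))))
  sound closed (hyp h) = ⊑⇒≤ (closed h)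

open Entailment using (sound; ⊕-⊑ˡ)

Closed : Hyps A → Lang A → Set
Closed H K = ∀ {e f} → H e f → Entailment._⊑_ K e f

Closed-⊢H : KA H ⊢H H' → Closed H K → Closed H' K
Closed-⊢H {K = K} ⊢H' closed h = ⊕-⊑ˡ K (proj₁ (sound K closed (⊢H' h)))

Closure-closed : Closed H (Closure H L)
Closure-closed h x p u v k = step {u = u} {v = v} h k p

Closure-least : Closed H K → L ⊆L K → Closure H L ⊆L K
Closure-least closed i w (base p) = i w p
Closure-least closed i _ (step {u = u} {v = v} h k p) =
  closed h _ p u v (λ y q → Closure-least closed i _ (k y q))

Closure-mono : L ⊆L M → Closure H L ⊆L Closure H M
Closure-mono i = Closure-least Closure-closed (λ w → base ∘ i w)

Closure-idem : Closure H (Closure H L) ⊆L Closure H L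
Closure-idem = Closure-least Closure-closed (λ _ p → p)

Closure-monoʰ : H ⊆H G → Closure H L ⊆L Closure G L
Closure-monoʰ H⊆G = Closure-least (Closure-closed ∘ H⊆G) (λ _ → base)

Closure-⊢H : KA H ⊢H H' → Closure H' L ⊆L Closure H L
Closure-⊢H {H = H} {L = L} ⊢H' =
  Closure-least (Closed-⊢H {K = Closure H L} ⊢H' Closure-closed) (λ _ → base)

KA-weaken : H ⊆H G → KA H ⊢ e ≈ f → KA G ⊢ e ≈ f
KA-weaken i refl = refl
KA-weaken i (sym d) = sym (KA-weaken i d)
KA-weaken i (trans d d') = trans (KA-weaken i d) (KA-weaken i d')
KA-weaken i (⊕-cong d d') = ⊕-cong (KA-weaken i d) (KA-weaken i d')
KA-weaken i (⊙-cong d d') = ⊙-cong (KA-weaken i d) (KA-weaken i d')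
KA-weaken i (⋆-cong d) = ⋆-cong (KA-weaken i d)
KA-weaken i ⊕-assoc = ⊕-assoc
KA-weaken i ⊕-comm = ⊕-comm
KA-weaken i ⊕-idem = ⊕-idem
KA-weaken i ⊕-zero = ⊕-zero
KA-weaken i ⊙-assoc = ⊙-assoc
KA-weaken i ⊙-oneˡ = ⊙-oneˡ
KA-weaken i ⊙-oneʳ = ⊙-oneʳ
KA-weaken i ⊙-zeroˡ = ⊙-zeroˡ
KA-weaken i ⊙-zeroʳ = ⊙-zeroʳ
KA-weaken i distribˡ = distribˡ
KA-weaken i distribʳ = distribʳ
KA-weaken i ⋆-unfold = ⋆-unfold
KA-weaken i (⋆-indˡ d) = ⋆-indˡ (KA-weaken i d)
KA-weaken i (⋆-indʳ d) = ⋆-indʳ (KA-weaken i d)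
KA-weaken i (hyp h) = hyp (i h)

⊢H-∪ : ∀ {H₁ H₂ H₁' H₂' : Hyps A} → KA H₁ ⊢H H₁' → KA H₂ ⊢H H₂' → KA (H₁ ∪H H₂) ⊢H (H₁' ∪H H₂')
⊢H-∪ ⊢H₁' ⊢H₂' (inj₁ h) = KA-weaken inj₁ (⊢H₁' h)
⊢H-∪ ⊢H₁' ⊢H₂' (inj₂ h) = KA-weaken inj₂ (⊢H₂' h)

lemma3p14 : {A : Set} (H₁ H₂ H₁' H₂' : Hyps A) →
    Reduces H₁ H₁' →
    Reduces H₂ H₂' →
    (∀ (L : Lang A) → Closure (H₁ ∪H H₂) L ⊆L Closure H₂ (Closure H₁ L)) →
    KA H₂' ⊢H H₁' →
    Reduces (H₁ ∪H H₂) (H₁' ∪H H₂')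
lemma3p14 H₁ H₂ H₁' H₂' (⊢H₁' , r₁ , red₁) (⊢H₂' , r₂ , red₂) split ⊢₂'H₁' =
  ⊢H-∪ ⊢H₁' ⊢H₂' , r₂ ∘ r₁ , λ e → equal e , closure e
  where
    equal : ∀ e → KA (H₁ ∪H H₂) ⊢ e ≈ r₂ (r₁ e)
    equal e = trans (KA-weaken inj₁ (proj₁ (red₁ e))) (KA-weaken inj₂ (proj₁ (red₂ (r₁ e))))

    H₁-into-H₂ : ∀ e → Closure H₁ ⟦ e ⟧ ⊆L Closure H₂ ⟦ r₁ e ⟧
    H₁-into-H₂ e = Closure-⊢H ⊢H₂' ∘ᴸ Closure-⊢H ⊢₂'H₁' ∘ᴸ proj₂ (red₁ e)

    closure : ∀ e → Closure (H₁ ∪H H₂) ⟦ e ⟧ ⊆L Closure (H₁' ∪H H₂') ⟦ r₂ (r₁ e) ⟧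
    closure e = Closure-monoʰ inj₂ ∘ᴸ proj₂ (red₂ (r₁ e)) ∘ᴸ Closure-idem
                ∘ᴸ Closure-mono (H₁-into-H₂ e) ∘ᴸ split ⟦ e ⟧
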